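{- Let $T_1$ and $T_2$ be standard composition tableaux of size $n$ and let $\sigma\in\mathfrak S_n$ be such that $T_2=\pi_\sigma T_1$. Then $T_1$ and $T_2$ belong to the same equivalence class $E$ under $\sim$. Let $\delta$ be the rank function of $E$. Then (1) $\delta(T_2)-\delta(T_1)=l(\mathrm{col}_{T_2}\mathrm{col}_{T_1}^{ -1})$; (2) $\delta(T_2)-\delta(T_1)\le l(\sigma)$, with equality if and only if $\sigma=\mathrm{col}_{T_2}\mathrm{col}_{T_1}^{ -1}$.
   Context: $\mathfrak S_n$ is the symmetric group on $[n]$, $s_i=(i,i+1)$, products are composition of functions. $l(\sigma)$ is the minimal $k$ with $\sigma=s_{j_k}\cdots s_{j_1}$ (such an expression is a reduced word). $H_n(0)$ is generated by $\pi_1,\dots,\pi_{n-1}$ with $\pi_i^2=\pi_i$, $\pi_i\pi_{i+1}\pi_i=\pi_{i+1}\pi_i\pi_{i+1}$, $\pi_i\pi_j=\pi_j\pi_i$ ($|i-j|\ge2$); $\pi_\sigma=\pi_{j_k}\cdots\pi_{j_1}$ for a reduced word $s_{j_k}\cdots s_{j_1}$ of $\sigma$. Compositions, diagrams (matrix coordinates, row 1 on top), the composition poset ($\beta\lessdot_c\alpha$ iff $\alpha=(1,\beta_1,\dots,\beta_l)$ or $\alpha$ is obtained from $\beta$ by increasing $\beta_k$ by one where $\beta_i\ne\beta_k$ for all $i<k$), skew shapes $\alpha/\!/\beta$ for $\beta\le_c\alpha$ (cells of $\alpha$ not in the copy of $\beta$ placed at the bottom of $\alpha$). A standard composition tableau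 (SCT) of shape $\alpha/\!/\beta$ of size $n=|\alpha|-|\beta|$ is a bijection $T:\alpha/\!/\beta\to[n]$ with rows decreasing left to right, first column increasing top to bottom, and the triple rule: with $T=\infty$ on cells of $\beta$, if $(j,k)\in\alpha/\!/\beta$, $(i,k-1)\in\alpha$, $j>i$ and $T(j,k)<T(i,k-1)$, then $(i,k)\in\alpha$ and $T(j,k)<T(i,k)$. With $c_T(k)$ the column of $T^{ -1}(k)$, a cell $(i,j)$ attacking $(i',j')$ if $j=j'$, $i\ne i'$ or $j=j'-1$, $i<i'$: $D(T)=\{i:c_T(i)\le c_T(i+1)\}$, $AD(T)=\{i\in D(T): T^{ -1}(i)\text{ attacks }T^{ -1}(i+1)\}$, $nAD(T)=D(T)\setminus AD(T)$. $H_n(0)$ acts on $\operatorname{span}_{\mathbb C}$ of SCTs of a fixed shape by $\pi_iT=T$ if $i\notin D(T)$, $0$ if $i\in AD(T)$, $s_iT$ (swap entries $i,i+1$) if $i\in nAD(T)$. $T_1\sim T_2$ (same shape) iff in each column the relative orders of entries coincide. For an equivalence class $E$ there is a unique source tableau $T_{0,E}\in E$, namely the unique $T\in E$ such that for every $i\in[n-1]$ with $c_T(i+1)<c_T(i)$ the cell of $i+1$ is immediately to the left of the cell of $i$ in the same row. The column word $\mathrm{col}_T$ is obtained by reading the columns left to right, each top to bottom, viewed as a permutation in one-line notation. The rank function of $E$ is $\delta(T)=l(\mathrm{col}_T\mathrm{col}_{T_{0,E}}^{ -1})$ for $T\in E$. -}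

module Defs where

open import Data.Nat using (ℕ; zero; suc; _≤_; _<_; _∸_; _⊔_; _≟_; _≤?_; _<?_)
open import Data.Fin using (Fin; toℕ; fromℕ<) renaming (_<_ to _<ᶠ_)
open import Data.Fin.Permutation.Components using (transpose)
open import Data.List using (List; []; _∷_; _++_; length; map; foldr; upTo; allFin; filter; concatMap; zip)
open import Data.List.Relation.Unary.All using (All)
open import Data.Product using (Σ; Σ-syntax; _×_; _,_; proj₁; proj₂)
open import Data.Product.Properties using (≡-dec)
open import Data.Sum using (_⊎_)
open import Data.Maybe using (Maybe; just; nothing; _>>=_)
open import Relation.Nullary using (¬_; Dec; yes; no)
open import Relation.Nullary.Decidable using (_×-dec_; _⊎-dec_; ¬?)
open import Relation.Binary.PropositionalEquality using (_≡_; _≢_)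
open import Relation.Binary.Construct.Closure.ReflexiveTransitive using (Star)
open import Function using (_∘_; id)
open import Function.Bundles using (_⇔_)

record Composition : Set where
  constructor mkComp
  field
    parts    : List ℕ
    positive : All (λ x → 0 < x) parts
open Composition public

data _⋖l_ : List ℕ → List ℕ → Set where
  prepend : ∀ β → β ⋖l (1 ∷ β)
  bump    : ∀ pre x post → All (λ y → y ≢ x) pre →
            (pre ++ x ∷ post) ⋖l (pre ++ suc x ∷ post)

_⋖c_ : Composition → Composition → Set
β ⋖c α = parts β ⋖l parts α

_≤c_ : Composition → Composition → Set
_≤c_ = Star _⋖c_

-- Diagrams (matrix coordinates, 1-indexed: (row , column), row 1 on top)

Cell : Set
Cell = ℕ × ℕ

row col : Cell → ℕ
row = proj₁
col = proj₂

-- i-th part (1-indexed) of a list of parts; 0 outside the range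
part : List ℕ → ℕ → ℕ
part xs       zero          = 0
part []       (suc i)       = 0
part (x ∷ xs) (suc zero)    = x
part (x ∷ xs) (suc (suc i)) = part xs (suc i)

InDiag : Composition → Cell → Set
InDiag α (i , j) = 1 ≤ j × j ≤ part (parts α) i

-- cell of the copy of β placed at the bottom of α
InBottom : Composition → Composition → Cell → Set
InBottom α β (i , j) =
  1 ≤ j × j ≤ part (parts β) (i ∸ (length (parts α) ∸ length (parts β)))

InSkew : Composition → Composition → Cell → Set
InSkew α β c = InDiag α c × ¬ InBottom α β c

-- Standard composition tableaux of shape α//β with entries [n]
-- (entries represented by Fin n, entry k ↔ toℕ k + 1); a tableau is
-- given by its inverse  pos = T⁻¹ : [n] → cells  (a bijection onto α//β).

record SCT (α β : Composition) (n : ℕ) : Set where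
  field
    pos    : Fin n → Cell
    inSkew : ∀ a → InSkew α β (pos a)
    inj    : ∀ a b → pos a ≡ pos b → a ≡ b
    surj   : ∀ c → InSkew α β c → Σ[ a ∈ Fin n ] pos a ≡ c
    rowDec : ∀ a b → row (pos a) ≡ row (pos b) → col (pos a) < col (pos b) → b <ᶠ a
    col1Inc : ∀ a b → col (pos a) ≡ 1 → col (pos b) ≡ 1 →
              row (pos a) < row (pos b) → a <ᶠ b
    -- triple rule, with T = ∞ on the cells of β:
    -- if (j,k+1) = pos a ∈ α//β, (i,k) ∈ α, j > i and T(j,k+1) < T(i,k),
    -- then (i,k+1) ∈ α and T(j,k+1) < T(i,k+1)
    triple : ∀ a i k → col (pos a) ≡ suc k → i < row (pos a) →
             InDiag α (i , k) →
             (InBottom α β (i , k) ⊎ Σ[ b ∈ Fin n ] (pos b ≡ (i , k) × a <ᶠ b)) →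
             InDiag α (i , suc k) ×
             (InBottom α β (i , suc k) ⊎ Σ[ b ∈ Fin n ] (pos b ≡ (i , suc k) × a <ᶠ b))
open SCT public

-- index i of s_i, as Fin n with i+1 < n  (s_i swaps i and i+1)
Letter : ℕ → Set
Letter n = Σ[ i ∈ Fin n ] (suc (toℕ i) < n)

lo hi : ∀ {n} → Letter n → Fin n
lo (i , _)  = i
hi (_ , p)  = fromℕ< p

s : ∀ {n} → Letter n → Fin n → Fin n
s x = transpose (lo x) (hi x)

-- s_{j_k} ⋯ s_{j_1} for the word  j_k ∷ ⋯ ∷ j_1 ∷ []  (composition of functions)
prod : ∀ {n} → List (Letter n) → Fin n → Fin n
prod []      = id
prod (x ∷ w) = s x ∘ prod w

Reduced : ∀ {n} → List (Letter n) → (Fin n → Fin n) → Set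
Reduced {n} w σ = (∀ a → prod w a ≡ σ a) ×
                  (∀ (w' : List (Letter n)) → (∀ a → prod w' a ≡ σ a) → length w ≤ length w')

LengthIs : ∀ {n} → (Fin n → Fin n) → ℕ → Set
LengthIs {n} σ m = Σ[ w ∈ List (Letter n) ] (Reduced w σ × length w ≡ m)

-- Descents, attacking, and the 0-Hecke action on tableaux.
-- The action sends a basis tableau to a tableau or to 0; we model this
-- on the position maps with  nothing = 0.

Attacks : Cell → Cell → Set
Attacks x y = (col x ≡ col y × ¬ (row x ≡ row y)) ⊎ (suc (col x) ≡ col y × row x < row y)

attacks? : ∀ x y → Dec (Attacks x y)
attacks? x y = ((col x ≟ col y) ×-dec ¬? (row x ≟ row y)) ⊎-dec
               ((suc (col x) ≟ col y) ×-dec (row x <? row y))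

πstep : ∀ {n} → Letter n → (Fin n → Cell) → Maybe (Fin n → Cell)
πstep x p with col (p (lo x)) ≤? col (p (hi x))
... | no _  = just p
... | yes _ with attacks? (p (lo x)) (p (hi x))
...   | yes _ = nothing
...   | no _  = just (p ∘ s x)

act : ∀ {n} → List (Letter n) → (Fin n → Cell) → Maybe (Fin n → Cell)
act []      p = just p
act (x ∷ w) p = act w p >>= πstep x

HeckeActs : ∀ {α β n} → List (Letter n) → SCT α β n → SCT α β n → Set
HeckeActs {n = n} w T₁ T₂ =
  Σ[ f ∈ (Fin n → Cell) ] (act w (pos T₁) ≡ just f × (∀ a → f a ≡ pos T₂ a))

_∼_ : ∀ {α β n} → SCT α β n → SCT α β n → Set
_∼_ {n = n} T₁ T₂ = ∀ (a b a' b' : Fin n) →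
  pos T₁ a ≡ pos T₂ a' → pos T₁ b ≡ pos T₂ b' →
  col (pos T₁ a) ≡ col (pos T₁ b) → (a <ᶠ b ⇔ a' <ᶠ b')

IsSource : ∀ {α β n} → SCT α β n → Set
IsSource {n = n} T = ∀ (x : Letter n) →
  col (pos T (hi x)) < col (pos T (lo x)) →
  row (pos T (hi x)) ≡ row (pos T (lo x)) × suc (col (pos T (hi x))) ≡ col (pos T (lo x))

entriesAt : ∀ {α β n} → SCT α β n → Cell → List (Fin n)
entriesAt {n = n} T c = filter (λ a → ≡-dec _≟_ _≟_ (pos T a) c) (allFin n)

colWord : ∀ {α β n} → SCT α β n → List (Fin n)
colWord {α} T =
  concatMap (λ j → concatMap (λ i → entriesAt T (i , j)) rows) cols
  where
  rows = map suc (upTo (length (parts α)))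
  cols = map suc (upTo (foldr _⊔_ 0 (parts α)))

-- ρ = col_{T₂} col_{T₁}⁻¹, i.e. ρ (col_{T₁}(p)) = col_{T₂}(p) for every position p
IsColQuot : ∀ {α β n} → SCT α β n → SCT α β n → (Fin n → Fin n) → Set
IsColQuot T₂ T₁ ρ = All (λ ab → ρ (proj₁ ab) ≡ proj₂ ab) (zip (colWord T₁) (colWord T₂))

ColLength : ∀ {α β n} → SCT α β n → SCT α β n → ℕ → Set
ColLength {n = n} T₂ T₁ m = Σ[ ρ ∈ (Fin n → Fin n) ] (IsColQuot T₂ T₁ ρ × LengthIs ρ m)

-- δ(T) = d, where δ is the rank function of the class with source T₀:
-- δ(T) = l(col_T col_{T₀}⁻¹)
RankIs : ∀ {α β n} → (T₀ T : SCT α β n) → ℕ → Set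
RankIs T₀ T d = ColLength T T₀ d

-- Acting by π_w on T₁ swaps the entries i, i+1 only when the cell of i lies strictly left of
-- the cell of i+1; the letters that act by a swap form a subword u of w, and T₂ is T₁ with its
-- entries relabelled by the permutation u. Such swaps never reverse two entries a < b with b
-- weakly left of a (the order ≺), whence T₁ ∼ T₂. The relabelling from the source tableau T₀ to
-- T₁ preserves ≺ as well (in a source tableau the column drops by at most one from i to i+1, and
-- only into the left neighbour), so each swap of u adds exactly one inversion to the relabelling
-- from T₀. As the length of a permutation is its number of inversions, δ(T₂) = δ(T₁) + |u| and
-- l(col_{T₂} col_{T₁}⁻¹) = |u| ≤ |w| = l(σ), with equality iff u = w, i.e. iff
-- σ = col_{T₂} col_{T₁}⁻¹.

module Submission where

open import Defs
open import Data.Nat using (ℕ)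
open import Data.Fin using (Fin)
open import Data.List using (List; length)
open import Data.Integer using (ℤ; +_; _-_; _≤_)
open import Data.Product using (Σ-syntax; _×_)
open import Relation.Binary.PropositionalEquality using (_≡_)
open import Function.Bundles using (_⇔_)

open import Data.Fin.Base using (zero; suc; toℕ; inject₁; _<_; _>_)
  renaming (_≤_ to _≤ᶠ_)
open import Data.Fin.Induction using (<-wellFounded; >-wellFounded)
import Data.Fin.Properties as Finₚ
open import Data.Integer using (+≤+; _⊖_)
import Data.Integer.Properties as ℤₚ
open import Data.List using ([]; _∷_; map; zip; filter; concatMap; upTo; foldr)
open import Data.List.Membership.Propositional using (_∈_; lose)
open import Data.List.Membership.Propositional.Properties
  using (∈-concatMap⁺; ∈-map⁺; ∈-upTo⁺; ∈-allFin)
open import Data.List.Properties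
  using (filter-accept; filter-reject; filter-none; map-concatMap; concatMap-cong)
open import Data.List.Relation.Binary.Pointwise using (Pointwise-≡⇒≡)
open import Data.List.Relation.Binary.Sublist.Propositional using (_⊆_; []; _∷_; _∷ʳ_)
open import Data.List.Relation.Binary.Sublist.Propositional.Properties using (length-mono-≤; to-≋)
open import Data.List.Relation.Unary.All as All using (All)
import Data.List.Relation.Unary.All.Properties as All
open import Data.List.Relation.Unary.AllPairs using (_∷_)
open import Data.List.Relation.Unary.Any using (here; there)
open import Data.List.Relation.Unary.Unique.Propositional using (Unique)
open import Data.List.Relation.Unary.Unique.Propositional.Properties using (allFin⁺)
open import Data.Maybe using (just)
open import Data.Maybe.Properties using (just-injective)
open import Data.Nat.Base as ℕ using (zero; suc; z≤n; s≤s)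
import Data.Nat.Properties as ℕₚ
open import Algebra.Properties.Monoid.Sum ℕₚ.+-0-monoid
  using (sum; sum-syntax; sum-cong-≗; sum-replicate-zero)
open import Data.Product using (∃; ∃₂; _,_; proj₁; proj₂)
open import Data.Product.Properties using (≡-dec; ×-≡,≡→≡)
open import Data.Sum using (_⊎_; inj₁; inj₂; [_,_]′)
open import Function using (_∘_; id)
open import Function.Bundles using (mk⇔; Equivalence)
open import Function.Definitions using (StrictlyInverseˡ; StrictlyInverseʳ)
open import Induction.WellFounded using (Acc; acc)
open import Relation.Binary.Core using (_Preserves_⟶_)
open import Relation.Binary.Definitions using (tri<; tri≈; tri>)
open import Relation.Binary.PropositionalEquality
  using (_≢_; _≗_; refl; sym; trans; cong; cong₂; subst; subst₂; module ≡-Reasoning)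
open import Relation.Nullary using (¬_; Dec; yes; no; contradiction)
open import Relation.Nullary.Decidable using (_×-dec_)
open import Relation.Unary using (Decidable)

private
  variable
    n : ℕ

𝟙 : ∀ {P : Set} → Dec P → ℕ
𝟙 (yes _) = 1
𝟙 (no _)  = 0

𝟙-yes : ∀ {P : Set} (P? : Dec P) → P → 𝟙 P? ≡ 1
𝟙-yes (yes _) _ = refl
𝟙-yes (no ¬p) p = contradiction p ¬p

𝟙-no : ∀ {P : Set} (P? : Dec P) → ¬ P → 𝟙 P? ≡ 0
𝟙-no (yes p) ¬p = contradiction p ¬p
𝟙-no (no _)  _  = refl

𝟙-cong : ∀ {P Q : Set} (P? : Dec P) (Q? : Dec Q) → P ⇔ Q → 𝟙 P? ≡ 𝟙 Q?
𝟙-cong P? (yes q) P⇔Q = 𝟙-yes P? (Equivalence.from P⇔Q q)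
𝟙-cong P? (no ¬q) P⇔Q = 𝟙-no P? (¬q ∘ Equivalence.to P⇔Q)

𝟙-positive : ∀ {P : Set} (P? : Dec P) → 0 ℕ.< 𝟙 P? → P
𝟙-positive (yes p) _ = p

sum-suc-at : ∀ {f g : Fin n → ℕ} (k : Fin n) →
             (∀ j → j ≢ k → f j ≡ g j) → g k ≡ suc (f k) → sum g ≡ suc (sum f)
sum-suc-at zero f≡g gk = cong₂ ℕ._+_ gk (sym (sum-cong-≗ (λ j → f≡g (suc j) λ ())))
sum-suc-at {f = f} (suc k) f≡g gk = trans
  (cong₂ ℕ._+_ (sym (f≡g zero λ ()))
               (sum-suc-at k (λ j j≢k → f≡g (suc j) (j≢k ∘ Finₚ.suc-injective)) gk))
  (ℕₚ.+-suc (f zero) _)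

sum-zero : ∀ {f : Fin n → ℕ} → (∀ k → f k ≡ 0) → sum f ≡ 0
sum-zero {n} f≡0 = trans (sum-cong-≗ f≡0) (sum-replicate-zero n)

term≤sum : ∀ (f : Fin n → ℕ) k → f k ℕ.≤ sum f
term≤sum f zero    = ℕₚ.m≤m+n (f zero) _
term≤sum f (suc k) = ℕₚ.≤-trans (term≤sum (f ∘ suc) k) (ℕₚ.m≤n+m _ (f zero))

sum-positive : ∀ (f : Fin n → ℕ) → 0 ℕ.< sum f → ∃ λ k → 0 ℕ.< f k
sum-positive {suc n} f 0<sum with f zero in eq
... | suc _ = zero , subst (0 ℕ.<_) (sym eq) (s≤s z≤n)
... | zero  = let k , 0<fk = sum-positive (f ∘ suc) 0<sum in suc k , 0<fk

hi-toℕ : ∀ (x : Letter n) → toℕ (hi x) ≡ suc (toℕ (lo x))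
hi-toℕ (_ , i+1<n) = Finₚ.toℕ-fromℕ< i+1<n

lo<hi : ∀ (x : Letter n) → lo x < hi x
lo<hi x = ℕₚ.≤-reflexive (sym (hi-toℕ x))

lo≢hi : ∀ (x : Letter n) → lo x ≢ hi x
lo≢hi x = Finₚ.<⇒≢ (lo<hi x)

s-lo : ∀ (x : Letter n) → s x (lo x) ≡ hi x
s-lo x with lo x Finₚ.≟ lo x
... | yes _   = refl
... | no ¬refl = contradiction refl ¬refl

s-hi : ∀ (x : Letter n) → s x (hi x) ≡ lo x
s-hi x with hi x Finₚ.≟ lo x
... | yes hi≡lo = contradiction (sym hi≡lo) (lo≢hi x)
... | no _ with hi x Finₚ.≟ hi x
...   | yes _    = refl
...   | no ¬refl = contradiction refl ¬refl

s-other : ∀ (x : Letter n) {k} → k ≢ lo x → k ≢ hi x → s x k ≡ k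
s-other x {k} k≢lo k≢hi with k Finₚ.≟ lo x
... | yes k≡lo = contradiction k≡lo k≢lo
... | no _ with k Finₚ.≟ hi x
...   | yes k≡hi = contradiction k≡hi k≢hi
...   | no _     = refl

s-involutive : ∀ (x : Letter n) k → s x (s x k) ≡ k
s-involutive x k = by-cases (k Finₚ.≟ lo x) (k Finₚ.≟ hi x)
  where
  by-cases : Dec (k ≡ lo x) → Dec (k ≡ hi x) → s x (s x k) ≡ k
  by-cases (yes refl) _          = trans (cong (s x) (s-lo x)) (s-hi x)
  by-cases (no _)     (yes refl) = trans (cong (s x) (s-hi x)) (s-lo x)
  by-cases (no k≢lo)  (no k≢hi)  =
    trans (cong (s x) (s-other x k≢lo k≢hi)) (s-other x k≢lo k≢hi)

s-preserves-< : ∀ (x : Letter n) {y z} → y < z → ¬ (y ≡ lo x × z ≡ hi x) → s x y < s x z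
s-preserves-< x {y} {z} y<z not-lo-hi =
  by-cases (y Finₚ.≟ lo x) (y Finₚ.≟ hi x) (z Finₚ.≟ lo x) (z Finₚ.≟ hi x)
  where
  by-cases : Dec (y ≡ lo x) → Dec (y ≡ hi x) → Dec (z ≡ lo x) → Dec (z ≡ hi x) →
             s x y < s x z
  by-cases (yes refl) _ _ (yes refl) = contradiction (refl , refl) not-lo-hi
  by-cases (yes refl) _ (yes refl) _ = contradiction y<z (ℕₚ.<-irrefl refl)
  by-cases (yes refl) _ (no z≢lo) (no z≢hi) =
    subst₂ _<_ (sym (s-lo x)) (sym (s-other x z≢lo z≢hi))
      (Finₚ.≤∧≢⇒< (subst (ℕ._≤ toℕ z) (sym (hi-toℕ x)) y<z) (z≢hi ∘ sym))
  by-cases (no _) (yes refl) _ _ =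
    subst₂ _<_ (sym (s-hi x)) (sym (s-other x z≢lo (Finₚ.<⇒≢ y<z ∘ sym)))
      (Finₚ.<-trans (lo<hi x) y<z)
    where
    z≢lo : z ≢ lo x
    z≢lo refl = ℕₚ.<-asym y<z (lo<hi x)
  by-cases (no y≢lo) (no y≢hi) (yes refl) _ =
    subst₂ _<_ (sym (s-other x y≢lo y≢hi)) (sym (s-lo x)) (Finₚ.<-trans y<z (lo<hi x))
  by-cases (no y≢lo) (no y≢hi) (no _) (yes refl) =
    subst₂ _<_ (sym (s-other x y≢lo y≢hi)) (sym (s-hi x))
      (Finₚ.≤∧≢⇒< (ℕₚ.≤-pred (subst (toℕ y ℕ.<_) (hi-toℕ x) y<z)) y≢lo)
  by-cases (no y≢lo) (no y≢hi) (no z≢lo) (no z≢hi) =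
    subst₂ _<_ (sym (s-other x y≢lo y≢hi)) (sym (s-other x z≢lo z≢hi)) y<z

letterAbove : ∀ {a b : Fin n} → a < b → Letter n
letterAbove {a = a} {b} a<b = a , ℕₚ.<-≤-trans (s≤s a<b) (Finₚ.toℕ<n b)

hi-letterAbove≤ : ∀ {a b : Fin n} (a<b : a < b) → hi (letterAbove a<b) ≤ᶠ b
hi-letterAbove≤ a<b = subst (ℕ._≤ _) (sym (hi-toℕ (letterAbove a<b))) a<b

record Invertible (h : Fin n → Fin n) : Set where
  field
    inverse  : Fin n → Fin n
    inverseˡ : StrictlyInverseˡ _≡_ h inverse
    inverseʳ : StrictlyInverseʳ _≡_ h inverse

  injective : ∀ {a b} → h a ≡ h b → a ≡ b
  injective {a} {b} ha≡hb = trans (sym (inverseʳ a)) (trans (cong inverse ha≡hb) (inverseʳ b))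

open Invertible

id-invertible : Invertible {n} id
id-invertible = record { inverse = id ; inverseˡ = λ _ → refl ; inverseʳ = λ _ → refl }

∘-invertible : ∀ {f g : Fin n → Fin n} → Invertible f → Invertible g → Invertible (f ∘ g)
∘-invertible {f = f} {g} F G = record
  { inverse  = inverse G ∘ inverse F
  ; inverseˡ = λ y → trans (cong f (inverseˡ G (inverse F y))) (inverseˡ F y)
  ; inverseʳ = λ a → trans (cong (inverse G) (inverseʳ F (g a))) (inverseʳ G a)
  }

s-invertible : ∀ (x : Letter n) → Invertible (s x)
s-invertible x = record
  { inverse = s x ; inverseˡ = s-involutive x ; inverseʳ = s-involutive x }

prod-invertible : ∀ (w : List (Letter n)) → Invertible (prod w)
prod-invertible []      = id-invertible
prod-invertible (x ∷ w) = ∘-invertible (s-invertible x) (prod-invertible w)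

-- Inversions

IsInversion : (Fin n → Fin n) → Fin n → Fin n → Set
IsInversion h i j = i < j × h j < h i

isInversion? : ∀ (h : Fin n → Fin n) i j → Dec (IsInversion h i j)
isInversion? h i j = (i Finₚ.<? j) ×-dec (h j Finₚ.<? h i)

inversions : (Fin n → Fin n) → ℕ
inversions {n} h = ∑[ i < n ] ∑[ j < n ] 𝟙 (isInversion? h i j)

inversions-cong : ∀ {h h′ : Fin n → Fin n} → h ≗ h′ → inversions h ≡ inversions h′
inversions-cong {h = h} {h′} h≗h′ = sum-cong-≗ λ i → sum-cong-≗ λ j →
  𝟙-cong (isInversion? h i j) (isInversion? h′ i j) (mk⇔
    (λ (i<j , hj<hi) → i<j , subst₂ _<_ (h≗h′ j) (h≗h′ i) hj<hi)
    (λ (i<j , h′j<h′i) → i<j , subst₂ _<_ (sym (h≗h′ j)) (sym (h≗h′ i)) h′j<h′i))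

inversions-id : inversions {n} id ≡ 0
inversions-id {n} = sum-zero {n} λ i → sum-zero {n} λ j →
  𝟙-no (isInversion? id i j) λ (i<j , j<i) → ℕₚ.<-asym i<j j<i

inversion⇒inversions>0 : ∀ {h : Fin n → Fin n} {i j} → IsInversion h i j → 0 ℕ.< inversions h
inversion⇒inversions>0 {h = h} {i} {j} inv = ℕₚ.≤-trans
  (ℕₚ.≤-reflexive (sym (𝟙-yes (isInversion? h i j) inv)))
  (ℕₚ.≤-trans (term≤sum (λ j → 𝟙 (isInversion? h i j)) j)
              (term≤sum (λ i → ∑[ j < _ ] 𝟙 (isInversion? h i j)) i))

inversions>0⇒inversion : ∀ (h : Fin n → Fin n) → 0 ℕ.< inversions h → ∃₂ (IsInversion h)
inversions>0⇒inversion h 0<inv =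
  let i , 0<row = sum-positive _ 0<inv
      j , 0<𝟙   = sum-positive _ 0<row
  in  i , j , 𝟙-positive (isInversion? h i j) 0<𝟙

module _ {h : Fin n → Fin n} (h-injective : ∀ {i j} → h i ≡ h j → i ≡ j)
         (x : Letter n) {a b : Fin n} (ha≡lo : h a ≡ lo x) (hb≡hi : h b ≡ hi x) (a<b : a < b)
         where

  private
    swap-inversion⇔ : ∀ i j → i ≢ a ⊎ j ≢ b → IsInversion h i j ⇔ IsInversion (s x ∘ h) i j
    swap-inversion⇔ i j i≢a⊎j≢b = mk⇔
      (λ (i<j , hj<hi) → i<j , s-preserves-< x hj<hi (not-b-a i<j))
      (λ (i<j , shj<shi) → i<j , subst₂ _<_ (s-involutive x (h j)) (s-involutive x (h i))
                                  (s-preserves-< x shj<shi not-a-b))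
      where
      not-a-b : ¬ (s x (h j) ≡ lo x × s x (h i) ≡ hi x)
      not-a-b (shj≡lo , shi≡hi) = [ (λ i≢a → i≢a i≡a) , (λ j≢b → j≢b j≡b) ]′ i≢a⊎j≢b
        where
        i≡a : i ≡ a
        i≡a = h-injective (trans (sym (s-involutive x (h i)))
                                 (trans (cong (s x) shi≡hi) (trans (s-hi x) (sym ha≡lo))))
        j≡b : j ≡ b
        j≡b = h-injective (trans (sym (s-involutive x (h j)))
                                 (trans (cong (s x) shj≡lo) (trans (s-lo x) (sym hb≡hi))))
      not-b-a : i < j → ¬ (h j ≡ lo x × h i ≡ hi x)
      not-b-a i<j (hj≡lo , hi≡hi) =
        ℕₚ.<-asym a<b (subst₂ _<_ (h-injective (trans hi≡hi (sym hb≡hi)))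
                                  (h-injective (trans hj≡lo (sym ha≡lo))) i<j)

  inversions-swap : inversions (s x ∘ h) ≡ suc (inversions h)
  inversions-swap = sum-suc-at a
    (λ i i≢a → sum-cong-≗ λ j → 𝟙-cong _ _ (swap-inversion⇔ i j (inj₁ i≢a)))
    (sum-suc-at b
      (λ j j≢b → 𝟙-cong _ _ (swap-inversion⇔ a j (inj₂ j≢b)))
      (trans (𝟙-yes (isInversion? (s x ∘ h) a b) (a<b , new-inversion))
             (cong suc (sym (𝟙-no (isInversion? h a b) λ (_ , hb<ha) → ℕₚ.<-asym hb<ha old-order)))))
    where
    new-inversion : s x (h b) < s x (h a)
    new-inversion = subst₂ _<_ (sym (trans (cong (s x) hb≡hi) (s-hi x)))
                               (sym (trans (cong (s x) ha≡lo) (s-lo x))) (lo<hi x)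
    old-order : h a < h b
    old-order = subst₂ _<_ (sym ha≡lo) (sym hb≡hi) (lo<hi x)

inversions-unswap : ∀ {h : Fin n → Fin n} → (∀ {i j} → h i ≡ h j → i ≡ j) →
                    ∀ (x : Letter n) {a b} → h a ≡ hi x → h b ≡ lo x → a < b →
                    inversions h ≡ suc (inversions (s x ∘ h))
inversions-unswap {h = h} h-injective x ha≡hi hb≡lo a<b = trans
  (inversions-cong (λ a → sym (s-involutive x (h a))))
  (inversions-swap (h-injective ∘ s-injective) x
    (trans (cong (s x) ha≡hi) (s-hi x)) (trans (cong (s x) hb≡lo) (s-lo x)) a<b)
  where
  s-injective : ∀ {i j} → s x i ≡ s x j → i ≡ j
  s-injective = injective (s-invertible x)

inversions-s∘≤ : ∀ {h : Fin n → Fin n} → Invertible h → ∀ (x : Letter n) →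
                 inversions (s x ∘ h) ℕ.≤ suc (inversions h)
inversions-s∘≤ {h = h} H x with Finₚ.<-cmp (inverse H (lo x)) (inverse H (hi x))
... | tri< a<b _ _ = ℕₚ.≤-reflexive
  (inversions-swap (injective H) x (inverseˡ H (lo x)) (inverseˡ H (hi x)) a<b)
... | tri≈ _ a≡b _ = contradiction
  (trans (sym (inverseˡ H (lo x))) (trans (cong h a≡b) (inverseˡ H (hi x)))) (lo≢hi x)
... | tri> _ _ b<a = ℕₚ.m≤n⇒m≤1+n (ℕₚ.<⇒≤ (ℕₚ.≤-reflexive
  (sym (inversions-unswap (injective H) x (inverseˡ H (hi x)) (inverseˡ H (lo x)) b<a))))

inversions-prod≤length : ∀ (w : List (Letter n)) → inversions (prod w) ℕ.≤ length w
inversions-prod≤length {n} []      = ℕₚ.≤-reflexive (inversions-id {n})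
inversions-prod≤length (x ∷ w) =
  ℕₚ.≤-trans (inversions-s∘≤ (prod-invertible w) x) (s≤s (inversions-prod≤length w))

strictlyIncreasing⇒≥ : ∀ {f : Fin n → Fin n} → f Preserves _<_ ⟶ _<_ →
                       ∀ a → Acc _<_ a → toℕ a ℕ.≤ toℕ (f a)
strictlyIncreasing⇒≥ f-mono zero    _        = z≤n
strictlyIncreasing⇒≥ {f = f} f-mono (suc a) (acc rs) = ℕₚ.≤-trans
  (s≤s (subst (ℕ._≤ toℕ (f (inject₁ a))) (Finₚ.toℕ-inject₁ a)
    (strictlyIncreasing⇒≥ f-mono (inject₁ a) (rs below))))
  (f-mono below)
  where
  below : inject₁ a < suc a
  below = s≤s (ℕₚ.≤-reflexive (Finₚ.toℕ-inject₁ a))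

inversions≡0⇒≗id : ∀ {ρ : Fin n → Fin n} → Invertible ρ → inversions ρ ≡ 0 → ρ ≗ id
inversions≡0⇒≗id {ρ = ρ} R inv≡0 a = Finₚ.toℕ-injective (ℕₚ.≤-antisym
  (subst (toℕ (ρ a) ℕ.≤_) (cong toℕ (inverseʳ R a))
    (strictlyIncreasing⇒≥ inverse-increasing (ρ a) (<-wellFounded (ρ a))))
  (strictlyIncreasing⇒≥ ρ-increasing a (<-wellFounded a)))
  where
  ρ-increasing : ρ Preserves _<_ ⟶ _<_
  ρ-increasing {i} {j} i<j with Finₚ.<-cmp (ρ i) (ρ j)
  ... | tri< ρi<ρj _ _ = ρi<ρj
  ... | tri≈ _ ρi≡ρj _ = contradiction (injective R ρi≡ρj) (Finₚ.<⇒≢ i<j)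
  ... | tri> _ _ ρj<ρi = contradiction inv≡0 (ℕₚ.<⇒≢ (inversion⇒inversions>0 (i<j , ρj<ρi)) ∘ sym)
  inverse-increasing : inverse R Preserves _<_ ⟶ _<_
  inverse-increasing {y} {z} y<z with Finₚ.<-cmp (inverse R y) (inverse R z)
  ... | tri< lt _ _ = lt
  ... | tri≈ _ eq _ = contradiction
    (trans (sym (inverseˡ R y)) (trans (cong ρ eq) (inverseˡ R z))) (Finₚ.<⇒≢ y<z)
  ... | tri> _ _ gt = contradiction
    (subst₂ _<_ (inverseˡ R z) (inverseˡ R y) (ρ-increasing gt)) (ℕₚ.<-asym y<z)

adjacent-descent : ∀ (f : Fin n → Fin n) {a b} → a < b → f b < f a →
                   ∃ λ x → f (hi x) < f (lo x)
adjacent-descent {n} f {a} a<b = go a (>-wellFounded a) a<b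
  where
  go : ∀ a → Acc _>_ a → ∀ {b} → a < b → f b < f a → ∃ λ x → f (hi x) < f (lo x)
  go a (acc rs) {b} a<b fb<fa = by-cases (f (hi x) Finₚ.<? f a) (hi x Finₚ.≟ b)
    where
    x : Letter n
    x = letterAbove a<b
    by-cases : Dec (f (hi x) < f a) → Dec (hi x ≡ b) → ∃ λ x → f (hi x) < f (lo x)
    by-cases (yes descent) _          = x , descent
    by-cases (no ¬descent) (yes a′≡b) =
      contradiction (subst (λ c → f c < f a) (sym a′≡b) fb<fa) ¬descent
    by-cases (no ¬descent) (no a′≢b)  = go (hi x) (rs (lo<hi x))
      (Finₚ.≤∧≢⇒< (hi-letterAbove≤ a<b) a′≢b) (ℕₚ.<-≤-trans fb<fa (ℕₚ.≮⇒≥ ¬descent))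

word-of-length-inversions : ∀ k {ρ : Fin n → Fin n} → Invertible ρ → inversions ρ ≡ k →
                            Σ[ w ∈ List (Letter n) ] (prod w ≗ ρ × length w ≡ k)
word-of-length-inversions zero    R inv≡0 = [] , (sym ∘ inversions≡0⇒≗id R inv≡0) , refl
word-of-length-inversions {n} (suc k) {ρ} R inv≡1+k =
  let w , prod-w≗sρ , length-w≡k = word-of-length-inversions k (∘-invertible (s-invertible x) R)
                                     (ℕₚ.suc-injective (trans (sym inv≡sinv) inv≡1+k))
  in  x ∷ w , (λ a → trans (cong (s x) (prod-w≗sρ a)) (s-involutive x (ρ a))) , cong suc length-w≡k
  where
  inversion : ∃₂ (IsInversion ρ)
  inversion = inversions>0⇒inversion ρ (subst (0 ℕ.<_) (sym inv≡1+k) (s≤s z≤n))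
  descent : ∃ λ x → inverse R (hi x) < inverse R (lo x)
  descent = let i , j , i<j , ρj<ρi = inversion in
    adjacent-descent (inverse R) ρj<ρi (subst₂ _<_ (sym (inverseʳ R i)) (sym (inverseʳ R j)) i<j)
  x : Letter n
  x = proj₁ descent
  inv≡sinv : inversions ρ ≡ suc (inversions (s x ∘ ρ))
  inv≡sinv = inversions-unswap (injective R) x (inverseˡ R (hi x)) (inverseˡ R (lo x))
                               (proj₂ descent)

lengthIs-inversions : ∀ {ρ : Fin n → Fin n} → Invertible ρ → LengthIs ρ (inversions ρ)
lengthIs-inversions {ρ = ρ} R =
  let w , prod-w≗ρ , length-w≡inv = word-of-length-inversions (inversions ρ) R refl
  in  w , (prod-w≗ρ , λ w′ prod-w′≗ρ → ℕₚ.≤-trans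
             (ℕₚ.≤-reflexive (trans length-w≡inv (inversions-cong (sym ∘ prod-w′≗ρ))))
             (inversions-prod≤length w′)) , length-w≡inv

subword-of-reduced : ∀ {σ : Fin n → Fin n} {u w} → Reduced w σ → u ⊆ w →
                     length u ≡ length w ⇔ prod u ≗ σ
subword-of-reduced {u = u} (prod-w≗σ , w-minimal) u⊆w = mk⇔
  (λ |u|≡|w| a → trans (cong (λ v → prod v a) (Pointwise-≡⇒≡ (to-≋ |u|≡|w| u⊆w))) (prod-w≗σ a))
  (λ prod-u≗σ → ℕₚ.≤-antisym (length-mono-≤ u⊆w) (w-minimal u prod-u≗σ))

-- Comparing two tableaux of the same shape cell by cell

filter-unique : ∀ {A : Set} {P : A → Set} (P? : Decidable P) {a : A} {xs} →
                Unique xs → a ∈ xs → P a → (∀ {y} → P y → y ≡ a) → filter P? xs ≡ a ∷ []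
filter-unique P? (x≢xs ∷ _) (here refl) Pa P⇒≡a = trans (filter-accept P? Pa)
  (cong (_ ∷_) (filter-none P? (All.map (λ x≢y Py → x≢y (sym (P⇒≡a Py))) x≢xs)))
filter-unique P? (x≢xs ∷ xs-unique) (there a∈xs) Pa P⇒≡a = trans
  (filter-reject P? (λ Px → All.lookup x≢xs a∈xs (P⇒≡a Px)))
  (filter-unique P? xs-unique a∈xs Pa P⇒≡a)

part-positive⇒row : ∀ xs i → 0 ℕ.< part xs i → ∃ λ r → i ≡ suc r × r ℕ.< length xs
part-positive⇒row (x ∷ xs) (suc zero)    _      = 0 , refl , s≤s z≤n
part-positive⇒row (x ∷ xs) (suc (suc i)) 0<part =
  let r , i≡r , r<len = part-positive⇒row xs (suc i) 0<part in suc r , cong suc i≡r , s≤s r<len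

part≤max : ∀ xs i → part xs i ℕ.≤ foldr ℕ._⊔_ 0 xs
part≤max xs       zero          = z≤n
part≤max []       (suc i)       = z≤n
part≤max (x ∷ xs) (suc zero)    = ℕₚ.m≤m⊔n x _
part≤max (x ∷ xs) (suc (suc i)) = ℕₚ.≤-trans (part≤max xs (suc i)) (ℕₚ.m≤n⊔m x _)

module _ {α β : Composition} where

  -- T′ ∘ T⁻¹ on entries, i.e. col_{T′} col_T⁻¹ (isColQuot⇔).
  entryMap : SCT α β n → SCT α β n → Fin n → Fin n
  entryMap T T′ a = proj₁ (surj T′ (pos T a) (inSkew T a))

  pos-entryMap : ∀ (T T′ : SCT α β n) a → pos T′ (entryMap T T′ a) ≡ pos T a
  pos-entryMap T T′ a = proj₂ (surj T′ (pos T a) (inSkew T a))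

  entryMap-unique : ∀ (T T′ : SCT α β n) {a b} → pos T′ b ≡ pos T a → entryMap T T′ a ≡ b
  entryMap-unique T T′ pos≡ = inj T′ _ _ (trans (pos-entryMap T T′ _) (sym pos≡))

  entryMap-invertible : ∀ (T T′ : SCT α β n) → Invertible (entryMap T T′)
  entryMap-invertible T T′ = record
    { inverse  = entryMap T′ T
    ; inverseˡ = λ b → entryMap-unique T T′ (sym (pos-entryMap T′ T b))
    ; inverseʳ = λ a → entryMap-unique T′ T (sym (pos-entryMap T T′ a))
    }

  entryMap-trans : ∀ (T T′ T″ : SCT α β n) → entryMap T T″ ≗ entryMap T′ T″ ∘ entryMap T T′
  entryMap-trans T T′ T″ a =
    entryMap-unique T T″ (trans (pos-entryMap T′ T″ _) (pos-entryMap T T′ a))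

  entriesAt-pos : ∀ (T : SCT α β n) a → entriesAt T (pos T a) ≡ a ∷ []
  entriesAt-pos {n} T a = filter-unique _ (allFin⁺ n) (∈-allFin a) refl (inj T _ _)

  entriesAt-empty : ∀ (T : SCT α β n) {c} → (∀ a → pos T a ≢ c) → entriesAt T c ≡ []
  entriesAt-empty T c-empty = filter-none _ (All.tabulate⁺ c-empty)

  entriesAt-entryMap : ∀ (T T′ : SCT α β n) c →
                       entriesAt T′ c ≡ map (entryMap T T′) (entriesAt T c)
  entriesAt-entryMap T T′ c with Finₚ.any? (λ a → ≡-dec ℕₚ._≟_ ℕₚ._≟_ (pos T a) c)
  ... | yes (a , refl) = begin
    entriesAt T′ (pos T a)                     ≡⟨ cong (entriesAt T′) (sym (pos-entryMap T T′ a)) ⟩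
    entriesAt T′ (pos T′ (entryMap T T′ a))    ≡⟨ entriesAt-pos T′ (entryMap T T′ a) ⟩
    entryMap T T′ a ∷ []                       ≡⟨ cong (map (entryMap T T′)) (entriesAt-pos T a) ⟨
    map (entryMap T T′) (entriesAt T (pos T a)) ∎
    where open ≡-Reasoning
  ... | no c-empty = trans
    (entriesAt-empty T′ λ b pos≡c → c-empty (entryMap T′ T b , trans (pos-entryMap T′ T b) pos≡c))
    (cong (map (entryMap T T′)) (sym (entriesAt-empty T λ a pos≡c → c-empty (a , pos≡c))))

  colWord-entryMap : ∀ (T T′ : SCT α β n) → colWord T′ ≡ map (entryMap T T′) (colWord T)
  colWord-entryMap {n} T T′ = sym (begin
    map φ (concatMap (λ j → concatMap (λ i → entriesAt T (i , j)) rows) cols)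
      ≡⟨ map-concatMap φ _ cols ⟩
    concatMap (λ j → map φ (concatMap (λ i → entriesAt T (i , j)) rows)) cols
      ≡⟨ concatMap-cong (λ j → map-concatMap φ _ rows) cols ⟩
    concatMap (λ j → concatMap (λ i → map φ (entriesAt T (i , j))) rows) cols
      ≡⟨ concatMap-cong (λ j → concatMap-cong (λ i → sym (entriesAt-entryMap T T′ (i , j))) rows) cols ⟩
    concatMap (λ j → concatMap (λ i → entriesAt T′ (i , j)) rows) cols ∎)
    where
    open ≡-Reasoning
    φ : Fin n → Fin n
    φ = entryMap T T′
    rows cols : List ℕ
    rows = map suc (upTo (length (parts α)))
    cols = map suc (upTo (foldr ℕ._⊔_ 0 (parts α)))

  ∈-colWord : ∀ (T : SCT α β n) a → a ∈ colWord T
  ∈-colWord T a with pos T a in pos≡ | inSkew T a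
  ... | (i , suc j) | (_ , j<part) , _
    with part-positive⇒row (parts α) i (ℕₚ.<-≤-trans (s≤s z≤n) j<part)
  ...   | r , refl , r<len =
    ∈-concatMap⁺ _ (lose (∈-map⁺ suc (∈-upTo⁺ j<max))
      (∈-concatMap⁺ _ (lose (∈-map⁺ suc (∈-upTo⁺ r<len))
        (subst (λ c → a ∈ entriesAt T c) pos≡ (subst (a ∈_) (sym (entriesAt-pos T a)) (here refl))))))
    where
    j<max : j ℕ.< foldr ℕ._⊔_ 0 (parts α)
    j<max = ℕₚ.≤-trans j<part (part≤max (parts α) (suc r))

  isColQuot⇔ : ∀ (T T′ : SCT α β n) (ρ : Fin n → Fin n) → IsColQuot T′ T ρ ⇔ ρ ≗ entryMap T T′
  isColQuot⇔ {n} T T′ ρ = mk⇔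
    (λ q a → All.lookup (All.map⁻ (subst (All _) zip≡ q)) (∈-colWord T a))
    (λ ρ≗φ → subst (All _) (sym zip≡) (All.map⁺ (All.tabulate λ {a} _ → ρ≗φ a)))
    where
    φ : Fin n → Fin n
    φ = entryMap T T′
    zip-map : ∀ xs → zip xs (map φ xs) ≡ map (λ a → a , φ a) xs
    zip-map []       = refl
    zip-map (a ∷ xs) = cong (_ ∷_) (zip-map xs)
    zip≡ : zip (colWord T) (colWord T′) ≡ map (λ a → a , φ a) (colWord T)
    zip≡ = trans (cong (zip (colWord T)) (colWord-entryMap T T′)) (zip-map (colWord T))

  colLength : ∀ (T T′ : SCT α β n) {h} → entryMap T T′ ≗ h → ColLength T′ T (inversions h)
  colLength T T′ φ≗h = entryMap T T′ , Equivalence.from (isColQuot⇔ T T′ _) (λ _ → refl) ,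
    subst (LengthIs _) (inversions-cong φ≗h) (lengthIs-inversions (entryMap-invertible T T′))

-- The column order, and source tableaux

_≺[_]_ : Fin n → (Fin n → Cell) → Fin n → Set
a ≺[ Q ] b = a < b × col (Q b) ℕ.≤ col (Q a)

∘-preserves-≺ : ∀ {Q : Fin n → Cell} {π h : Fin n → Fin n} →
                π Preserves _≺[ Q ∘ π ]_ ⟶ _<_ → h Preserves _≺[ Q ]_ ⟶ _<_ →
                (h ∘ π) Preserves _≺[ Q ∘ π ]_ ⟶ _<_
∘-preserves-≺ π-preserves h-preserves a≺b@(_ , cb≤ca) = h-preserves (π-preserves a≺b , cb≤ca)

preserves-≺-cong : ∀ {Q Q′ : Fin n → Cell} {h : Fin n → Fin n} → Q ≗ Q′ →
                   h Preserves _≺[ Q ]_ ⟶ _<_ → h Preserves _≺[ Q′ ]_ ⟶ _<_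
preserves-≺-cong Q≗Q′ h-preserves {a} {b} (a<b , cb≤ca) =
  h-preserves (a<b , subst₂ ℕ._≤_ (cong col (sym (Q≗Q′ b))) (cong col (sym (Q≗Q′ a))) cb≤ca)

preserves-≺⇒sameColumn⇔ : ∀ {Q : Fin n → Cell} {h : Fin n → Fin n} → h Preserves _≺[ Q ]_ ⟶ _<_ →
                          ∀ {a b} → col (Q a) ≡ col (Q b) → a < b ⇔ h a < h b
preserves-≺⇒sameColumn⇔ {h = h} h-preserves {a} {b} ca≡cb = mk⇔
  (λ a<b → h-preserves (a<b , ℕₚ.≤-reflexive (sym ca≡cb)))
  from
  where
  from : h a < h b → a < b
  from ha<hb with Finₚ.<-cmp a b
  ... | tri< a<b _ _ = a<b
  ... | tri≈ _ refl _ = contradiction ha<hb (ℕₚ.<-irrefl refl)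
  ... | tri> _ _ b<a = contradiction (h-preserves (b<a , ℕₚ.≤-reflexive ca≡cb)) (ℕₚ.<-asym ha<hb)

∼-intro : ∀ {α β} (T T′ : SCT α β n) → entryMap T T′ Preserves _≺[ pos T ]_ ⟶ _<_ → T ∼ T′
∼-intro T T′ φ-preserves a b a′ b′ a↦a′ b↦b′ ca≡cb =
  subst₂ (λ a′ b′ → a < b ⇔ a′ < b′)
    (entryMap-unique T T′ (sym a↦a′)) (entryMap-unique T T′ (sym b↦b′))
    (preserves-≺⇒sameColumn⇔ {Q = pos T} φ-preserves ca≡cb)

preserves-≺⇒ordered-preimages : ∀ {Q : Fin n → Cell} {h : Fin n → Fin n} (H : Invertible h) →
                                h Preserves _≺[ Q ]_ ⟶ _<_ → ∀ x →
                                col (Q (inverse H (lo x))) ℕ.≤ col (Q (inverse H (hi x))) →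
                                inverse H (lo x) < inverse H (hi x)
preserves-≺⇒ordered-preimages {h = h} H h-preserves x c-lo≤c-hi
  with Finₚ.<-cmp (inverse H (lo x)) (inverse H (hi x))
... | tri< lo′<hi′ _ _ = lo′<hi′
... | tri≈ _ lo′≡hi′ _ = contradiction
  (trans (sym (inverseˡ H (lo x))) (trans (cong h lo′≡hi′) (inverseˡ H (hi x)))) (lo≢hi x)
... | tri> _ _ hi′<lo′ = contradiction
  (subst₂ _<_ (inverseˡ H (hi x)) (inverseˡ H (lo x)) (h-preserves (hi′<lo′ , c-lo≤c-hi)))
  (ℕₚ.<-asym (lo<hi x))

intermediate-value : ∀ (c : Fin n → ℕ) → (∀ x → c (lo x) ℕ.≤ suc (c (hi x))) →
                     ∀ {v a b} → a ≤ᶠ b → c b ℕ.≤ v → v ℕ.≤ c a →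
                     ∃ λ j → a ≤ᶠ j × j ≤ᶠ b × c j ≡ v
intermediate-value {n} c unit-drops {v} {a} = go a (>-wellFounded a)
  where
  go : ∀ a → Acc _>_ a → ∀ {b} → a ≤ᶠ b → c b ℕ.≤ v → v ℕ.≤ c a →
       ∃ λ j → a ≤ᶠ j × j ≤ᶠ b × c j ≡ v
  go a (acc rs) {b} a≤b cb≤v v≤ca with c a ℕₚ.≟ v
  ... | yes ca≡v = a , ℕₚ.≤-refl , a≤b , ca≡v
  ... | no ca≢v =
    let j , a′≤j , j≤b , cj≡v = go (hi x) (rs (lo<hi x)) (hi-letterAbove≤ a<b) cb≤v v≤ca′
    in  j , ℕₚ.<⇒≤ (ℕₚ.<-≤-trans (lo<hi x) a′≤j) , j≤b , cj≡v
    where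
    v<ca : v ℕ.< c a
    v<ca = ℕₚ.≤∧≢⇒< v≤ca (ca≢v ∘ sym)
    a<b : a < b
    a<b = Finₚ.≤∧≢⇒< a≤b λ { refl → ℕₚ.<⇒≱ v<ca cb≤v }
    x : Letter n
    x = letterAbove a<b
    v≤ca′ : v ℕ.≤ c (hi x)
    v≤ca′ = ℕₚ.≤-pred (ℕₚ.<-≤-trans v<ca (unit-drops x))

module _ {α β : Composition} (T₀ T : SCT α β n) (T₀-source : IsSource T₀) (T₀∼T : T₀ ∼ T) where

  private
    c : Fin n → ℕ
    c = col ∘ pos T₀

    φ : Fin n → Fin n
    φ = entryMap T₀ T

    sameColumn-< : ∀ {a b} → a < b → c a ≡ c b → φ a < φ b
    sameColumn-< {a} {b} a<b ca≡cb = Equivalence.to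
      (T₀∼T a b (φ a) (φ b) (sym (pos-entryMap T₀ T a)) (sym (pos-entryMap T₀ T b)) ca≡cb) a<b

    leftNeighbour-< : ∀ x → c (hi x) ℕ.< c (lo x) → φ (lo x) < φ (hi x)
    leftNeighbour-< x c-hi<c-lo = rowDec T (φ (hi x)) (φ (lo x))
      (trans (cong row (pos-entryMap T₀ T (hi x)))
             (trans (proj₁ (T₀-source x c-hi<c-lo)) (sym (cong row (pos-entryMap T₀ T (lo x))))))
      (subst₂ ℕ._<_ (sym (cong col (pos-entryMap T₀ T (hi x))))
                    (sym (cong col (pos-entryMap T₀ T (lo x)))) c-hi<c-lo)

    columns-drop-by-one : ∀ x → c (lo x) ℕ.≤ suc (c (hi x))
    columns-drop-by-one x with c (hi x) ℕₚ.<? c (lo x)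
    ... | yes c-hi<c-lo = ℕₚ.≤-reflexive (sym (proj₂ (T₀-source x c-hi<c-lo)))
    ... | no c-hi≮c-lo  = ℕₚ.m≤n⇒m≤1+n (ℕₚ.≮⇒≥ c-hi≮c-lo)

    -- Either the successor of a is its left neighbour, or (columns dropping by at most one per
    -- step) some later entry returns to the column of a before b.
    next-stop : ∀ {a b} → a < b → c b ℕ.< c a →
                ∃ λ j → a < j × j ≤ᶠ b × c b ℕ.≤ c j × φ a < φ j
    next-stop {a} {b} a<b cb<ca = by-cases (c (hi x) ℕₚ.<? c a)
      where
      x : Letter n
      x = letterAbove a<b
      by-cases : Dec (c (hi x) ℕ.< c a) → ∃ λ j → a < j × j ≤ᶠ b × c b ℕ.≤ c j × φ a < φ j
      by-cases (yes ca′<ca) = hi x , lo<hi x , hi-letterAbove≤ a<b ,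
        ℕₚ.≤-pred (ℕₚ.<-≤-trans cb<ca (columns-drop-by-one x)) , leftNeighbour-< x ca′<ca
      by-cases (no ca′≮ca) =
        let j , a′≤j , j≤b , cj≡ca = intermediate-value c columns-drop-by-one
                                       (hi-letterAbove≤ a<b) (ℕₚ.<⇒≤ cb<ca) (ℕₚ.≮⇒≥ ca′≮ca)
            a<j = ℕₚ.<-≤-trans (lo<hi x) a′≤j
        in  j , a<j , j≤b , ℕₚ.≤-trans (ℕₚ.<⇒≤ cb<ca) (ℕₚ.≤-reflexive (sym cj≡ca)) ,
            sameColumn-< a<j (sym cj≡ca)

  source-entryMap-preserves-≺ : entryMap T₀ T Preserves _≺[ pos T₀ ]_ ⟶ _<_
  source-entryMap-preserves-≺ {a} (a<b , cb≤ca) = go a (>-wellFounded a) a<b cb≤ca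
    where
    go : ∀ a → Acc _>_ a → ∀ {b} → a < b → c b ℕ.≤ c a → φ a < φ b
    go a (acc rs) {b} a<b cb≤ca with c b ℕₚ.≟ c a
    ... | yes cb≡ca = sameColumn-< a<b (sym cb≡ca)
    ... | no cb≢ca with next-stop a<b (ℕₚ.≤∧≢⇒< cb≤ca cb≢ca)
    ...   | j , a<j , j≤b , cb≤cj , φa<φj with j Finₚ.≟ b
    ...     | yes refl = φa<φj
    ...     | no j≢b   = Finₚ.<-trans φa<φj (go j (rs a<j) (Finₚ.≤∧≢⇒< j≤b j≢b) cb≤cj)

-- The 0-Hecke action

swapped : (Fin n → Cell) → List (Letter n) → Fin n → Cell
swapped P u = P ∘ inverse (prod-invertible u)

swapped-prod : ∀ (P : Fin n → Cell) u a → swapped P u (prod u a) ≡ P a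
swapped-prod P u a = cong P (inverseʳ (prod-invertible u) a)

data Ascending (P : Fin n → Cell) : List (Letter n) → Set where
  []  : Ascending P []
  _∷_ : ∀ {x u} → col (swapped P u (lo x)) ℕ.< col (swapped P u (hi x)) →
        Ascending P u → Ascending P (x ∷ u)

nonAttacking⇒col< : ∀ {c d : Cell} → c ≢ d → col c ℕ.≤ col d → ¬ Attacks c d → col c ℕ.< col d
nonAttacking⇒col< {c} {d} c≢d cc≤cd ¬attacks with col c ℕₚ.≟ col d
... | no cc≢cd = ℕₚ.≤∧≢⇒< cc≤cd cc≢cd
... | yes cc≡cd = contradiction
  (inj₁ (cc≡cd , λ rc≡rd → c≢d (×-≡,≡→≡ (rc≡rd , cc≡cd)))) ¬attacks

πstep-just : ∀ (x : Letter n) {g f} → πstep x g ≡ just f →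
             f ≡ g ⊎ (col (g (lo x)) ℕ.≤ col (g (hi x)) × ¬ Attacks (g (lo x)) (g (hi x)) ×
                      f ≡ g ∘ s x)
πstep-just x {g} step≡f with col (g (lo x)) ℕₚ.≤? col (g (hi x))
... | no _ = inj₁ (sym (just-injective step≡f))
... | yes cols≤ with attacks? (g (lo x)) (g (hi x))
...   | no ¬attacks = inj₂ (cols≤ , ¬attacks , sym (just-injective step≡f))

act-just : ∀ (x : Letter n) w P {f} → act (x ∷ w) P ≡ just f →
           ∃ λ g → act w P ≡ just g × πstep x g ≡ just f
act-just x w P step≡f with act w P
... | just g = g , refl , step≡f

swapped-injective : ∀ {P : Fin n → Cell} → (∀ a b → P a ≡ P b → a ≡ b) →
                    ∀ u {a b} → swapped P u a ≡ swapped P u b → a ≡ b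
swapped-injective {n} P-injective u {a} {b} Pa≡Pb = trans (sym (inverseˡ U a))
  (trans (cong (prod u) (P-injective _ _ Pa≡Pb)) (inverseˡ U b))
  where
  U : Invertible (prod u)
  U = prod-invertible u

act≡swapped : ∀ {P : Fin n → Cell} → (∀ a b → P a ≡ P b → a ≡ b) →
              ∀ w {f} → act w P ≡ just f → ∃ λ u → u ⊆ w × Ascending P u × f ≡ swapped P u
act≡swapped P-injective [] refl = [] , [] , [] , refl
act≡swapped {P = P} P-injective (x ∷ w) act≡f with act-just x w P act≡f
... | g , act≡g , step≡f with act≡swapped P-injective w act≡g
...   | u , u⊆w , ascending , refl with πstep-just x {swapped P u} step≡f
...     | inj₁ refl = u , x ∷ʳ u⊆w , ascending , refl
...     | inj₂ (cols≤ , ¬attacks , refl) =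
  x ∷ u , refl ∷ u⊆w ,
  nonAttacking⇒col< (lo≢hi x ∘ swapped-injective P-injective u) cols≤ ¬attacks ∷ ascending , refl

ascending-preserves-≺ : ∀ {P : Fin n → Cell} {u} → Ascending P u → prod u Preserves _≺[ P ]_ ⟶ _<_
ascending-preserves-≺ []                          (a<b , _)     = a<b
ascending-preserves-≺ {P = P} (_∷_ {x} {u} ascent ascending) {a} {b} (a<b , cb≤ca) =
  s-preserves-< x (ascending-preserves-≺ ascending (a<b , cb≤ca)) λ (ua≡lo , ub≡hi) →
    ℕₚ.<⇒≱ (subst₂ (λ p q → col p ℕ.< col q)
              (trans (cong (swapped P u) (sym ua≡lo)) (swapped-prod P u a))
              (trans (cong (swapped P u) (sym ub≡hi)) (swapped-prod P u b)) ascent)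
           cb≤ca

ascending-inversions : ∀ {P : Fin n → Cell} {u} → Ascending P u →
                       ∀ {π} → Invertible π → π Preserves _≺[ P ∘ π ]_ ⟶ _<_ →
                       inversions (prod u ∘ π) ≡ inversions π ℕ.+ length u
ascending-inversions [] {π} _ _ = sym (ℕₚ.+-identityʳ (inversions π))
ascending-inversions {n} {P = P} (_∷_ {x} {u} ascent ascending) {π} Π π-preserves = begin
  inversions (s x ∘ k)            ≡⟨ inversions-swap (injective K) x (inverseˡ K (lo x))
                                                                      (inverseˡ K (hi x)) a<b ⟩
  suc (inversions k)              ≡⟨ cong suc (ascending-inversions ascending Π π-preserves) ⟩
  suc (inversions π ℕ.+ length u) ≡⟨ ℕₚ.+-suc (inversions π) (length u) ⟨
  inversions π ℕ.+ suc (length u) ∎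
  where
  open ≡-Reasoning
  k : Fin n → Fin n
  k = prod u ∘ π
  K : Invertible k
  K = ∘-invertible (prod-invertible u) Π
  πk⁻¹ : ∀ y → P (π (inverse K y)) ≡ swapped P u y
  πk⁻¹ y = cong P (inverseˡ Π _)
  a<b : inverse K (lo x) < inverse K (hi x)
  a<b = preserves-≺⇒ordered-preimages {Q = P ∘ π} K
    (∘-preserves-≺ {Q = P} π-preserves (ascending-preserves-≺ ascending)) x
    (ℕₚ.<⇒≤ (subst₂ (λ p q → col p ℕ.< col q) (sym (πk⁻¹ (lo x))) (sym (πk⁻¹ (hi x))) ascent))

record HeckeTrace {α β : Composition} (w : List (Letter n)) (T₁ T₂ : SCT α β n) : Set where
  field
    swaps         : List (Letter n)
    swaps⊆w       : swaps ⊆ w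
    ascending     : Ascending (pos T₁) swaps
    entryMap≗prod : entryMap T₁ T₂ ≗ prod swaps

module _ {α β : Composition} {w : List (Letter n)} {T₁ T₂ : SCT α β n} where

  heckeTrace : HeckeActs w T₁ T₂ → HeckeTrace w T₁ T₂
  heckeTrace (f , act≡f , f≗pos₂) with act≡swapped (inj T₁) w act≡f
  ... | u , u⊆w , ascending , refl = record
    { swaps = u ; swaps⊆w = u⊆w ; ascending = ascending
    ; entryMap≗prod = λ a → entryMap-unique T₁ T₂
        (trans (sym (f≗pos₂ (prod u a))) (swapped-prod (pos T₁) u a))
    }

  module _ (τ : HeckeTrace w T₁ T₂) where
    open HeckeTrace τ

    heckeTrace⇒∼ : T₁ ∼ T₂
    heckeTrace⇒∼ = ∼-intro T₁ T₂ λ {a} {b} →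
      subst₂ _<_ (sym (entryMap≗prod a)) (sym (entryMap≗prod b)) ∘ ascending-preserves-≺ ascending

    heckeTrace-colLength : ColLength T₂ T₁ (length swaps)
    heckeTrace-colLength = subst (ColLength T₂ T₁)
      (trans (ascending-inversions ascending id-invertible proj₁)
             (cong (ℕ._+ length swaps) (inversions-id {n})))
      (colLength T₁ T₂ entryMap≗prod)

    heckeTrace-rank : ∀ T₀ → IsSource T₀ → T₀ ∼ T₁ →
                      RankIs T₀ T₂ (inversions (entryMap T₀ T₁) ℕ.+ length swaps)
    heckeTrace-rank T₀ T₀-source T₀∼T₁ = subst (ColLength T₂ T₀)
      (ascending-inversions ascending (entryMap-invertible T₀ T₁)
        (preserves-≺-cong (sym ∘ pos-entryMap T₀ T₁)
                          (source-entryMap-preserves-≺ T₀ T₁ T₀-source T₀∼T₁)))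
      (colLength T₀ T₂ λ a → trans (entryMap-trans T₀ T₁ T₂ a) (entryMap≗prod (entryMap T₀ T₁ a)))

    heckeTrace-full⇔colQuot : ∀ {σ} → Reduced w σ → length swaps ≡ length w ⇔ IsColQuot T₂ T₁ σ
    heckeTrace-full⇔colQuot {σ} w-reduced = mk⇔
      (λ |u|≡|w| → Equivalence.from (isColQuot⇔ T₁ T₂ σ) λ a →
        trans (sym (Equivalence.to subword⇔ |u|≡|w| a)) (sym (entryMap≗prod a)))
      (λ colQuot → Equivalence.from subword⇔ λ a →
        trans (sym (entryMap≗prod a)) (sym (Equivalence.to (isColQuot⇔ T₁ T₂ σ) colQuot a)))
      where
      subword⇔ : length swaps ≡ length w ⇔ prod swaps ≗ σ
      subword⇔ = subword-of-reduced w-reduced swaps⊆w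

+[m+n]-+m≡+n : ∀ m n → + (m ℕ.+ n) - + m ≡ + n
+[m+n]-+m≡+n m n = begin
  + (m ℕ.+ n) - + m  ≡⟨ ℤₚ.[+m]-[+n]≡m⊖n (m ℕ.+ n) m ⟩
  (m ℕ.+ n) ⊖ m      ≡⟨ ℤₚ.⊖-≥ (ℕₚ.m≤m+n m n) ⟩
  + (m ℕ.+ n ℕ.∸ m)  ≡⟨ cong +_ (ℕₚ.m+n∸m≡n m n) ⟩
  + n                ∎
  where open ≡-Reasoning

corollary2p24 : ∀ {α β : Composition} → β ≤c α → ∀ {n : ℕ}
    (T₁ T₂ : SCT α β n) (σ : Fin n → Fin n) (w : List (Letter n)) →
    Reduced w σ → HeckeActs w T₁ T₂ →
    (T₁ ∼ T₂) ×
    (∀ (T₀ : SCT α β n) → IsSource T₀ → T₀ ∼ T₁ →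
      Σ[ d₁ ∈ ℕ ] Σ[ d₂ ∈ ℕ ] Σ[ m ∈ ℕ ]
        (RankIs T₀ T₁ d₁ × RankIs T₀ T₂ d₂ × ColLength T₂ T₁ m ×
         ((+ d₂ - + d₁) ≡ + m) ×
         ((+ d₂ - + d₁) ≤ + length w) ×
         (((+ d₂ - + d₁) ≡ + length w) ⇔ IsColQuot T₂ T₁ σ)))
corollary2p24 _ T₁ T₂ σ w w-reduced acts = heckeTrace⇒∼ τ , λ T₀ T₀-source T₀∼T₁ →
  let d₁ = inversions (entryMap T₀ T₁)
      difference = +[m+n]-+m≡+n d₁ L
  in  d₁ , d₁ ℕ.+ L , L ,
      colLength T₀ T₁ {entryMap T₀ T₁} (λ _ → refl) ,
      heckeTrace-rank τ T₀ T₀-source T₀∼T₁ ,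
      heckeTrace-colLength τ ,
      difference ,
      subst (_≤ + length w) (sym difference) (+≤+ (length-mono-≤ (HeckeTrace.swaps⊆w τ))) ,
      mk⇔ (Equivalence.to full⇔colQuot ∘ ℤₚ.+-injective ∘ trans (sym difference))
          (trans difference ∘ cong +_ ∘ Equivalence.from full⇔colQuot)
  where
  τ : HeckeTrace w T₁ T₂
  τ = heckeTrace acts
  L : ℕ
  L = length (HeckeTrace.swaps τ)
  full⇔colQuot : L ≡ length w ⇔ IsColQuot T₂ T₁ σ
  full⇔colQuot = heckeTrace-full⇔colQuot τ w-reduced
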